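{- Let $r\ge1$ and $\alpha,\beta,\gamma^1,\dots,\gamma^r\in\mathrm{ord}$. (1) If $\alpha\le\beta$ and $\beta<\alpha,\gamma^1,\dots,\gamma^r$, then $\beta<\gamma^1,\dots,\gamma^r$. (2) If $\beta<\alpha$ and $\alpha\le\beta,\gamma^1,\dots,\gamma^r$, then $\alpha\le\gamma^1,\dots,\gamma^r$.
   Context: The setting is constructive. Let $\mathfrak F$ be a set of index sets containing $\mathbb N$ and every $\mathbb N_k=\{n\in\mathbb N:n<k\}$, closed (up to isomorphism) under finitely enumerated subsets, sets of finitely enumerated subsets, and disjoint unions indexed by elements of $\mathfrak F$. The set $\mathrm{ord}=\mathrm{ord}_{\mathfrak F}$ is defined inductively: a distinguished element $\underline 0$, and for every $I\in\mathfrak F$ and family $(\alpha_i)_{i\in I}$ in $\mathrm{ord}$ an element $\mathrm S(\alpha_i)_{i\in I}$. For $\alpha=\mathrm S(\alpha_i)_{i\in I}$, $\mathrm{In}_\alpha=I$; by convention $\mathrm{In}_{\underline0}=\emptyset$. For a finite list $F\subseteq_f\mathrm{In}_\alpha$, $\alpha_F$ is the list of the $\alpha_i$, $i\in F$. By simultaneous induction ($m\ge1$): $\alpha\le\beta^1,\dots,\beta^m$ means $\alpha_i<\beta^1,\dots,\beta^m$ for all $i\in\mathrm{In}_\alpha$; $\alpha<\beta^1,\dots,\beta^m$ means there exist finite lists $F_k\subseteq_f\mathrm{In}_{\beta^k}$, not all empty, with $\alpha\le\beta^1_{F_1},\dots,\beta^m_{F_m}$ (the concatenated list); $m=1$ gives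 binary $\le,<$. -}

module Defs where

open import Data.Empty using (⊥)
open import Data.Unit using (⊤; tt)
open import Data.Product using (Σ; _×_; _,_)
open import Data.Sum using (_⊎_)
open import Data.List using (List; []; _∷_; _++_; map)

-- An index family 𝔉 is presented as a universe: a type of codes U and
-- a decoding El : U → Set (each code names an index set I ∈ 𝔉).
module OrdTheory {U : Set} (El : U → Set) where

  data Ord : Set where
    0̲ : Ord
    S  : (I : U) → (El I → Ord) → Ord

  In : Ord → Set
  In 0̲ = ⊥
  In (S I f) = El I

  sub : (α : Ord) → In α → Ord
  sub 0̲ ()
  sub (S I f) i = f i

  subs : (α : Ord) → List (In α) → List Ord
  subs α F = map (sub α) F

  Sel : List Ord → Set
  Sel [] = ⊤
  Sel (β ∷ βs) = List (In β) × Sel βs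

  collect : (βs : List Ord) → Sel βs → List Ord
  collect [] tt = []
  collect (β ∷ βs) (F , Fs) = subs β F ++ collect βs Fs

  IsNonEmpty : {A : Set} → List A → Set
  IsNonEmpty [] = ⊥
  IsNonEmpty (_ ∷ _) = ⊤

  NotAllEmpty : (βs : List Ord) → Sel βs → Set
  NotAllEmpty [] tt = ⊥
  NotAllEmpty (β ∷ βs) (F , Fs) = IsNonEmpty F ⊎ NotAllEmpty βs Fs

  mutual
    _≤_ : Ord → List Ord → Set
    0̲ ≤ βs = ⊤
    S I f ≤ βs = (i : El I) → f i < βs

    _<_ : Ord → List Ord → Set
    α < βs = Σ (Sel βs) λ F → NotAllEmpty βs F × (α ≤ collect βs F)

{-# OPTIONS --safe #-}
-- Both parts reduce to the cancellation law  β < β,Γ ⇒ β < Γ : in (1), α ≤ β turns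
-- β < α,Γ into β < β,Γ; in (2), β < α and α ≤ β,Γ give β < β,Γ, and the resulting
-- β ≤ Γ removes β from α ≤ β,Γ.  Cancellation is proved for all members of a finite
-- list K at once (if each is < K,Γ then each is < Γ) by well-founded induction on K,
-- a list preceding K when it consists of immediate components of members of K: all of
-- K lies below a single list M of components K₁ of K and of Γ, the list K₁ again
-- satisfies the hypothesis, and once K₁ < Γ the whole of M is < Γ.  The induction is
-- well-founded since accessibility holds for singletons by structural induction and is
-- preserved by finite unions.
module Submission where

open import Defs
open import Data.Product using (Σ; ∃₂; _×_; _,_)
open import Data.Sum using (inj₁; inj₂)
open import Data.Unit using (tt)
open import Data.List using (List; []; _∷_; _++_)
open import Data.List.Properties using (++-identityʳ)
open import Data.List.Relation.Unary.All as All using (All; []; _∷_)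
open import Data.List.Relation.Unary.All.Properties using (++⁺; map⁺)
open import Data.List.Relation.Unary.Any using (here; there)
open import Data.List.Membership.Propositional using (_∈_)
open import Data.List.Membership.Propositional.Properties using (∈-++⁺ʳ; ∈-++⁻)
open import Data.List.Relation.Binary.Subset.Propositional using (_⊆_)
open import Data.List.Relation.Binary.Subset.Propositional.Properties
  using (⊆-refl; ⊆-trans; xs⊆x∷xs; ∷⁺ʳ; ∈-∷⁺ʳ; xs⊆xs++ys; xs⊆ys++xs; ++⁺ʳ)
open import Induction.WellFounded using (Acc; acc; WellFounded)
open import Relation.Binary.PropositionalEquality using (refl; sym; subst)

module OrdProperties {U : Set} (El : U → Set) where
  open OrdTheory El

  private
    variable
      α β x : Ord
      Δ Δ' Γ Ψ Ω A B K L Q : List Ord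

  ∈⇒nonEmpty : x ∈ Δ → IsNonEmpty Δ
  ∈⇒nonEmpty (here _) = tt
  ∈⇒nonEmpty (there _) = tt

  nonEmpty-⊆ : Δ ⊆ Δ' → IsNonEmpty Δ → IsNonEmpty Δ'
  nonEmpty-⊆ {_ ∷ _} Δ⊆Δ' _ = ∈⇒nonEmpty (Δ⊆Δ' (here refl))

  data _∈Sub_ : Ord → List Ord → Set where
    sub∈ : β ∈ Δ → (i : In β) → sub β i ∈Sub Δ

  ∈Sub-mono : Δ ⊆ Δ' → x ∈Sub Δ → x ∈Sub Δ'
  ∈Sub-mono Δ⊆Δ' (sub∈ m i) = sub∈ (Δ⊆Δ' m) i

  ∈Sub-++⁻ : (A : List Ord) → All (_∈Sub (A ++ B)) Q →
             ∃₂ λ QA QB → All (_∈Sub A) QA × All (_∈Sub B) QB × Q ⊆ QA ++ QB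
  ∈Sub-++⁻ A [] = [] , [] , [] , [] , λ ()
  ∈Sub-++⁻ A (sub∈ {β} m i ∷ Q⊑) with ∈Sub-++⁻ A Q⊑ | ∈-++⁻ A m
  ... | QA , QB , QA⊑ , QB⊑ , Q⊆ | inj₁ m∈A =
    sub β i ∷ QA , QB , sub∈ m∈A i ∷ QA⊑ , QB⊑ , ∷⁺ʳ (sub β i) Q⊆
  ... | QA , QB , QA⊑ , QB⊑ , Q⊆ | inj₂ m∈B =
    QA , sub β i ∷ QB , QA⊑ , sub∈ m∈B i ∷ QB⊑ ,
    ∈-∷⁺ʳ (∈-++⁺ʳ QA (here refl)) (⊆-trans Q⊆ (++⁺ʳ QA (xs⊆x∷xs QB (sub β i))))

  -- α < Δ with the selections F_k replaced by the list β¹_{F₁},…,βᵐ_{Fₘ} they pick out.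
  _<ˡ_ : Ord → List Ord → Set
  α <ˡ Δ = Σ (List Ord) λ L → IsNonEmpty L × All (_∈Sub Δ) L × α ≤ L

  emptySel : (Δ : List Ord) → Sel Δ
  emptySel [] = tt
  emptySel (β ∷ Δ) = [] , emptySel Δ

  insert : β ∈ Δ → In β → Sel Δ → Sel Δ
  insert (here refl) i (F , Fs) = i ∷ F , Fs
  insert (there m) i (F , Fs) = F , insert m i Fs

  insert-∈ : (m : β ∈ Δ) (i : In β) (F : Sel Δ) → sub β i ∈ collect Δ (insert m i F)
  insert-∈ (here refl) i (F , Fs) = here refl
  insert-∈ {Δ = β ∷ _} (there m) i (F , Fs) = ∈-++⁺ʳ (subs β F) (insert-∈ m i Fs)

  collect-insert : (m : β ∈ Δ) (i : In β) (F : Sel Δ) → collect Δ F ⊆ collect Δ (insert m i F)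
  collect-insert (here refl) i (F , Fs) = there
  collect-insert {Δ = β ∷ _} (there m) i (F , Fs) = ++⁺ʳ (subs β F) (collect-insert m i Fs)

  select : All (_∈Sub Δ) L → Σ (Sel Δ) λ F → L ⊆ collect Δ F
  select {Δ} [] = emptySel Δ , λ ()
  select (sub∈ m i ∷ L⊑) =
    let F , L⊆ = select L⊑
    in insert m i F , ∈-∷⁺ʳ (insert-∈ m i F) (⊆-trans L⊆ (collect-insert m i F))

  collect-⊑ : (F : Sel Δ) → All (_∈Sub Δ) (collect Δ F)
  collect-⊑ {[]} tt = []
  collect-⊑ {β ∷ Δ} (F , Fs) =
    ++⁺ (map⁺ (All.universal (sub∈ (here refl)) F)) (All.map (∈Sub-mono there) (collect-⊑ Fs))

  collect-nonEmpty : (F : Sel Δ) → NotAllEmpty Δ F → IsNonEmpty (collect Δ F)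
  collect-nonEmpty {β ∷ Δ} (_ ∷ _ , Fs) (inj₁ _) = tt
  collect-nonEmpty {β ∷ Δ} (F , Fs) (inj₂ ne) =
    nonEmpty-⊆ (xs⊆ys++xs _ (subs β F)) (collect-nonEmpty Fs ne)

  ∈-collect⇒notAllEmpty : (F : Sel Δ) → x ∈ collect Δ F → NotAllEmpty Δ F
  ∈-collect⇒notAllEmpty {β ∷ Δ} ([] , Fs) x∈ = inj₂ (∈-collect⇒notAllEmpty Fs x∈)
  ∈-collect⇒notAllEmpty {β ∷ Δ} (_ ∷ _ , Fs) _ = inj₁ tt

  <⇒<ˡ : α < Δ → α <ˡ Δ
  <⇒<ˡ {Δ = Δ} (F , ne , α≤) = collect Δ F , collect-nonEmpty F ne , collect-⊑ F , α≤

  <ˡ-mono : Δ ⊆ Δ' → α <ˡ Δ → α <ˡ Δ'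
  <ˡ-mono Δ⊆Δ' (L , ne , L⊑ , α≤L) = L , ne , All.map (∈Sub-mono Δ⊆Δ') L⊑ , α≤L

  mutual
    ≤-mono : (α : Ord) → Δ ⊆ Δ' → α ≤ Δ → α ≤ Δ'
    ≤-mono 0̲ _ _ = tt
    ≤-mono (S I f) Δ⊆Δ' α≤Δ i = <ˡ⇒< (f i) (<ˡ-mono Δ⊆Δ' (<⇒<ˡ (α≤Δ i)))

    <ˡ⇒< : (α : Ord) → α <ˡ Δ → α < Δ
    <ˡ⇒< α (x ∷ L , _ , L⊑ , α≤L) =
      let F , L⊆ = select L⊑
      in F , ∈-collect⇒notAllEmpty F (L⊆ (here refl)) , ≤-mono α L⊆ α≤L

  ≤⇒sub< : (β : Ord) → β ≤ Δ → (i : In β) → sub β i < Δ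
  ≤⇒sub< (S I f) β≤Δ i = β≤Δ i

  ≤-refl : (α : Ord) → α ≤ (α ∷ [])
  ≤-refl 0̲ = tt
  ≤-refl (S I f) i = <ˡ⇒< (f i) (f i ∷ [] , tt , sub∈ (here refl) i ∷ [] , ≤-refl (f i))

  ⊆⇒All≤ : Ψ ⊆ Ω → All (_≤ Ω) Ψ
  ⊆⇒All≤ Ψ⊆Ω = All.tabulate λ {x} x∈Ψ → ≤-mono x (λ { (here refl) → Ψ⊆Ω x∈Ψ }) (≤-refl x)

  ∈Sub⇒≤ : (x : Ord) → x ∈Sub Δ → x ≤ Δ
  ∈Sub⇒≤ 0̲ _ = tt
  ∈Sub⇒≤ (S J g) x∈ k =
    <ˡ⇒< (g k) (S J g ∷ [] , tt , x∈ ∷ [] , ∈Sub⇒≤ (g k) (sub∈ (here refl) k))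

  sub-<ˡ : All (_≤ Ω) Ψ → x ∈Sub Ψ → x <ˡ Ω
  sub-<ˡ Ψ≤Ω (sub∈ {β} m i) = <⇒<ˡ (≤⇒sub< β (All.lookup Ψ≤Ω m) i)

  ∈Sub⇒<ˡ : x ∈Sub Δ → x <ˡ Δ
  ∈Sub⇒<ˡ = sub-<ˡ (⊆⇒All≤ ⊆-refl)

  flatten : All (_<ˡ Ω) L →
            Σ (List Ord) λ M → All (_∈Sub Ω) M × All (_≤ M) L × (IsNonEmpty L → IsNonEmpty M)
  flatten [] = [] , [] , [] , λ ()
  flatten {L = y ∷ L} ((M₀ , ne₀ , M₀⊑ , y≤M₀) ∷ L<) =
    let M , M⊑ , L≤M , _ = flatten L<
    in M₀ ++ M , ++⁺ M₀⊑ M⊑ ,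
       ≤-mono y (xs⊆xs++ys M₀ M) y≤M₀ ∷ All.map (λ {z} → ≤-mono z (xs⊆ys++xs M M₀)) L≤M ,
       λ _ → nonEmpty-⊆ (xs⊆xs++ys M₀ M) ne₀

  mutual
    ≤-trans : (α : Ord) → α ≤ Ψ → All (_≤ Ω) Ψ → α ≤ Ω
    ≤-trans 0̲ _ _ = tt
    ≤-trans (S I f) α≤Ψ Ψ≤Ω i = <ˡ⇒< (f i) (<ˡ-transˡ (f i) (<⇒<ˡ (α≤Ψ i)) Ψ≤Ω)

    <ˡ-transˡ : (α : Ord) → α <ˡ Ψ → All (_≤ Ω) Ψ → α <ˡ Ω
    <ˡ-transˡ α (L , ne , L⊑Ψ , α≤L) Ψ≤Ω = ≤-<ˡ-trans α α≤L ne (All.map (sub-<ˡ Ψ≤Ω) L⊑Ψ)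

    ≤-<ˡ-trans : (α : Ord) → α ≤ Ψ → IsNonEmpty Ψ → All (_<ˡ Ω) Ψ → α <ˡ Ω
    ≤-<ˡ-trans α α≤Ψ ne Ψ<Ω =
      let M , M⊑Ω , Ψ≤M , neM = flatten Ψ<Ω
      in M , neM ne , M⊑Ω , ≤-trans α α≤Ψ Ψ≤M

  <ˡ⇒≤ : (α : Ord) → α <ˡ Δ → α ≤ Δ
  <ˡ⇒≤ α (L , _ , L⊑Δ , α≤L) = ≤-trans α α≤L (All.map (λ {x} → ∈Sub⇒≤ x) L⊑Δ)

  -- K must be nonempty, otherwise [] ⊏ [].
  _⊏_ : List Ord → List Ord → Set
  Q ⊏ K = IsNonEmpty K × All (_∈Sub K) Q

  acc-[] : Acc _⊏_ []
  acc-[] = acc λ ()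

  acc-⊆ : Q ⊆ K → Acc _⊏_ K → Acc _⊏_ Q
  acc-⊆ Q⊆K (acc rs) = acc λ (neQ , Q'⊑Q) → rs (nonEmpty-⊆ Q⊆K neQ , All.map (∈Sub-mono Q⊆K) Q'⊑Q)

  acc-++ : Acc _⊏_ A → Acc _⊏_ B → Acc _⊏_ (A ++ B)
  acc-++ {A} {B} (acc rsA) (acc rsB) = acc λ (_ , Q⊑) →
    let QA , QB , QA⊑A , QB⊑B , Q⊆ = ∈Sub-++⁻ A Q⊑
    in acc-⊆ Q⊆ (acc-parts QA⊑A QB⊑B)
    where
    acc-parts : ∀ {QA QB} → All (_∈Sub A) QA → All (_∈Sub B) QB → Acc _⊏_ (QA ++ QB)
    acc-parts [] [] = acc-[]
    acc-parts [] QB⊑@(sub∈ m _ ∷ _) = rsB (∈⇒nonEmpty m , QB⊑)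
    acc-parts {QA} QA⊑@(sub∈ m _ ∷ _) [] =
      subst (Acc _⊏_) (sym (++-identityʳ QA)) (rsA (∈⇒nonEmpty m , QA⊑))
    acc-parts QA⊑@(sub∈ m _ ∷ _) QB⊑@(sub∈ m' _ ∷ _) =
      acc-++ (rsA (∈⇒nonEmpty m , QA⊑)) (rsB (∈⇒nonEmpty m' , QB⊑))

  acc-All : All (λ x → Acc _⊏_ (x ∷ [])) Q → Acc _⊏_ Q
  acc-All [] = acc-[]
  acc-All (acc-x ∷ acc-Q) = acc-++ acc-x (acc-All acc-Q)

  acc-children : ((i : In β) → Acc _⊏_ (sub β i ∷ [])) → Q ⊏ (β ∷ []) → Acc _⊏_ Q
  acc-children acc-sub (_ , Q⊑) = acc-All (All.map (λ { (sub∈ (here refl) i) → acc-sub i }) Q⊑)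

  acc-[_] : (α : Ord) → Acc _⊏_ (α ∷ [])
  acc-[ 0̲ ] = acc (acc-children λ ())
  acc-[ S I f ] = acc (acc-children λ i → acc-[ f i ])

  ⊏-wellFounded : WellFounded _⊏_
  ⊏-wellFounded K = acc-All (All.tabulate λ {x} _ → acc-[ x ])

  <ˡ-cancel : (K Γ : List Ord) → Acc _⊏_ K → All (_<ˡ (K ++ Γ)) K → All (_<ˡ Γ) K
  <ˡ-cancel [] Γ _ _ = []
  <ˡ-cancel K@(_ ∷ _) Γ (acc rs) K<K++Γ =
    let M , M⊑K++Γ , K≤M , neM = flatten K<K++Γ
        K₁ , MΓ , K₁⊑K , MΓ⊑Γ , M⊆ = ∈Sub-++⁻ K M⊑K++Γ
        K≤K₁++MΓ = All.map (λ {κ} → ≤-mono κ M⊆) K≤M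
        K₁++MΓ≤K₁++Γ = ++⁺ (⊆⇒All≤ (xs⊆xs++ys K₁ Γ))
                           (All.map (λ {y} y∈ → ≤-mono y (xs⊆ys++xs Γ K₁) (∈Sub⇒≤ y y∈)) MΓ⊑Γ)
        K≤K₁++Γ = All.map (λ {κ} κ≤ → ≤-trans κ κ≤ K₁++MΓ≤K₁++Γ) K≤K₁++MΓ
        K₁<Γ = <ˡ-cancel K₁ Γ (rs (tt , K₁⊑K)) (All.map (sub-<ˡ K≤K₁++Γ) K₁⊑K)
        K₁++MΓ<Γ = ++⁺ K₁<Γ (All.map ∈Sub⇒<ˡ MΓ⊑Γ)
    in All.map (λ {κ} κ≤ → ≤-<ˡ-trans κ κ≤ (nonEmpty-⊆ M⊆ (neM tt)) K₁++MΓ<Γ) K≤K₁++MΓ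

  <ˡ-cancel₁ : β <ˡ (β ∷ Γ) → β <ˡ Γ
  <ˡ-cancel₁ {β} {Γ} β<β∷Γ = All.head (<ˡ-cancel (β ∷ []) Γ (⊏-wellFounded _) (β<β∷Γ ∷ []))

  <-cancel-≤ : (α β : Ord) (Γ : List Ord) → α ≤ (β ∷ []) → β < (α ∷ Γ) → β < Γ
  <-cancel-≤ α β Γ α≤β β<α∷Γ =
    <ˡ⇒< β (<ˡ-cancel₁ (<ˡ-transˡ β (<⇒<ˡ β<α∷Γ)
      (≤-mono α (xs⊆xs++ys (β ∷ []) Γ) α≤β ∷ ⊆⇒All≤ (xs⊆x∷xs Γ β))))

  ≤-cancel-< : (α β : Ord) (Γ : List Ord) → β < (α ∷ []) → α ≤ (β ∷ Γ) → α ≤ Γ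
  ≤-cancel-< α β Γ β<α α≤β∷Γ =
    ≤-trans α α≤β∷Γ (<ˡ⇒≤ β (<ˡ-cancel₁ (<ˡ-transˡ β (<⇒<ˡ β<α) (α≤β∷Γ ∷ []))) ∷ ⊆⇒All≤ ⊆-refl)

lemma4p12 : {U : Set} (El : U → Set) →
    let open OrdTheory El in
    (α β γ : Ord) (γs : List Ord) →
    ((α ≤ (β ∷ []) → β < (α ∷ γ ∷ γs) → β < (γ ∷ γs))
    × (β < (α ∷ []) → α ≤ (β ∷ γ ∷ γs) → α ≤ (γ ∷ γs)))
lemma4p12 El α β γ γs = <-cancel-≤ α β (γ ∷ γs) , ≤-cancel-< α β (γ ∷ γs)
  where open OrdProperties El
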